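{- The external induction schema holds in the topos $\mathcal{N}$: for every formula $\Phi(n)$ of $\mathcal{L}_{\mathrm{st}}$ with $n:\mathbb{N}$ (possibly with further free variables), every universally closed instance of $\big(\Phi(0) \land \forall^{\mathrm{st}} n:\mathbb{N} \,(\Phi(n) \to \Phi(\mathrm{S}n) )\big) \to \forall^{\mathrm{st}} n:\mathbb{N} \, \Phi(n)$ is valid in $\mathcal{N}$.
   Context: Let $\mathfrak{F}\mathbf{Set}$ be the category whose objects are pairs $(C,(\mathcal{F}_i)_{i\in I})$ with $C$ a set and $(\mathcal{F}_i)_{i\in I}$ an inhabited family of subsets of $C$ (base sets) such that for all $i,j$ there is $k$ with $\mathcal{F}_k\subseteq\mathcal{F}_i\cap\mathcal{F}_j$. A morphism $(C,\mathcal{F}_I)\to(D,\mathcal{G}_J)$ is an equivalence class of functions $\alpha:\mathcal{F}_i\to D$ defined on some base set, such that for all $j\in J$ there is $i'$ with $\mathcal{F}_{i'}\subseteq\alpha^{ -1}(\mathcal{G}_j)$; two such are equivalent if they agree on some base set contained in both domains. A set $S$ is identified with $(S,\{S\})$. $K$ is the Grothendieck topology in which a finite family $\{\beta_k:\mathcal{G}_k\to\mathcal{F}\}_{k=1}^n$ is covering iff for every choice of base sets $\mathcal{G}_{k,j_k}$ there is a base set $\mathcal{F}_i\subseteq\bigcup_k\beta_k(\mathcal{G}_{k,j_k})$. $\mathcal{N}:=\mathrm{Sh}(\mathfrak{F}\mathbf{Set},K)$. $\Delta S$ is the sheaf with $(\Delta S)\mathcal{F}$ = morphisms $\mathcal{F}\to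 S$ taking finitely many values. $\mathcal{L}$ is a many-sorted first-order language with a fixed interpretation in $\mathbf{Set}$, here having a type $\mathbb{N}$ interpreted as the natural numbers with constant $0$ and successor $\mathrm{S}$; $\mathcal{L}_{\mathrm{st}}$ adds predicates $\mathrm{st}_S$. Interpretation in $\mathcal{N}$: $S\mapsto\mathbf{y}S$, symbols via Yoneda, $\mathrm{st}_S\mapsto\Delta S$. $\forall^{\mathrm{st}}n\,\Phi := \forall n(\mathrm{st}(n)\to\Phi)$. A schema holds in $\mathcal{N}$ if all its universally closed instances are valid in the internal logic. -}

module Defs where

open import Level using (0ℓ)
open import Data.Nat using (ℕ; zero; suc)
open import Data.Fin using (Fin)
open import Data.Unit using (⊤; tt)
open import Data.Empty using (⊥)
open import Data.Product using (Σ; _×_; _,_; proj₁; proj₂)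
open import Data.Sum using (_⊎_)
open import Data.List using (List; []; _∷_)
open import Data.List.Relation.Unary.All as All using (All; []; _∷_)
open import Data.List.Membership.Propositional using (_∈_)
open import Data.List.Relation.Unary.Any using (here; there)
open import Relation.Nullary using (¬_)
open import Relation.Binary.PropositionalEquality using (_≡_; refl)

-- An object (C, (𝓕_i)_{i ∈ I}): a set C and an inhabited, downward
-- directed family of subsets of C.  Subsets are predicates whose
-- membership is a proposition.
record Obj : Set₁ where
  field
    Car      : Set
    Idx      : Set
    base     : Idx → Car → Set
    baseProp : ∀ i x (p q : base i x) → p ≡ q
    inh      : Idx
    dir      : ∀ i j → Σ Idx λ k → ∀ x → base k x → base i x × base j x
open Obj public

-- A set S viewed as the object (S, {S}).
setObj : Set → Obj
setObj S = record
  { Car = S ; Idx = ⊤ ; base = λ _ _ → ⊤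
  ; baseProp = λ { _ _ tt tt → refl } ; inh = tt
  ; dir = λ _ _ → tt , λ _ _ → tt , tt }

𝟙 : Obj
𝟙 = setObj ⊤

-- A representative of a morphism G → F: a function on a base set of G
-- such that every base set of F has a preimage containing a base set
-- of G.  (Morphisms are equivalence classes of these; all notions below
-- are invariant under the equivalence.)
record Hom (G F : Obj) : Set where
  field
    dom  : Idx G
    fun  : (y : Car G) → base G dom y → Car F
    cont : ∀ i → Σ (Idx G) λ j → ∀ y → base G j y →
             Σ (base G dom y) λ q → base F i (fun y q)
open Hom public

-- A representative of a morphism F → S (S a set), i.e. an element of
-- (𝐲 S)(F).  The continuity condition is trivial in this case.
record Elt (F : Obj) (S : Set) : Set where
  constructor elt
  field
    edom : Idx F
    val  : (x : Car F) → base F edom x → S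
open Elt public

-- two representatives denote the same morphism
EqElt : ∀ {F S} → Elt F S → Elt F S → Set
EqElt {F} a b = Σ (Idx F) λ k → ∀ x → base F k x →
  Σ (base F (edom a) x) λ q → Σ (base F (edom b) x) λ r → val a x q ≡ val b x r

restrict : ∀ {G F S} → Hom G F → Elt F S → Elt G S
restrict β a = elt (proj₁ (cont β (edom a)))
  λ y p → val a (fun β y (proj₁ (proj₂ (cont β (edom a)) y p)))
                (proj₂ (proj₂ (cont β (edom a)) y p))

constElt : ∀ {F S} → S → Elt F S
constElt {F} s = elt (inh F) λ _ _ → s

mapElt : ∀ {F S T} → (S → T) → Elt F S → Elt F T
mapElt f a = elt (edom a) λ x p → f (val a x p)

pairElt : ∀ {F S T} → Elt F S → Elt F T → Elt F (S × T)
pairElt {F} a b =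
  elt (proj₁ (dir F (edom a) (edom b)))
      λ x p → val a x (proj₁ (proj₂ (dir F (edom a) (edom b)) x p))
            , val b x (proj₂ (proj₂ (dir F (edom a) (edom b)) x p))

-- the morphism a : F → S lies in the subobject given by R ⊆ S
-- (it factors through 𝐲R ↪ 𝐲S): on some base set it lands in R.
InSub : ∀ {F S} → (S → Set) → Elt F S → Set
InSub {F} R a = Σ (Idx F) λ k → ∀ x → (p : base F k x) →
  Σ (base F (edom a) x) λ q → R (val a x q)

-- a ∈ (Δ S)(F): the morphism takes finitely many values, i.e. some
-- restriction of the representative to a base set has finite image.
FinVal : ∀ {F S} → Elt F S → Set
FinVal {F} {S} a = Σ (Idx F) λ k → Σ ℕ λ n → Σ (Fin n → S) λ v →
  ∀ x → (p : base F k x) → Σ (base F (edom a) x) λ q → Σ (Fin n) λ m →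
    val a x q ≡ v m

-- Finite families of morphisms into F and the topology K:
-- {β_k : 𝓖_k → 𝓕} covers iff for every choice of base sets 𝓖_{k,j_k}
-- some base set of 𝓕 is contained in ⋃_k β_k(𝓖_{k,j_k}).
Family : Obj → ℕ → Set₁
Family F n = Fin n → Σ Obj λ G → Hom G F

Covers : ∀ {F n} → Family F n → Set
Covers {F} {n} fam =
  (ch : (k : Fin n) → Idx (proj₁ (fam k))) →
  Σ (Idx F) λ i → ∀ x → base F i x →
    Σ (Fin n) λ k → Σ (Car (proj₁ (fam k))) λ y →
      Σ (base (proj₁ (fam k)) (ch k) y) λ _ →
      Σ (base (proj₁ (fam k)) (dom (proj₂ (fam k))) y) λ q →
        fun (proj₂ (fam k)) y q ≡ x

-- Many-sorted language with a fixed interpretation in Set, containing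
-- a sort ℕ (interpreted as the natural numbers) with 0 and S.

data Sort (B : Set) : Set where
  natS  : Sort B
  baseS : B → Sort B

interpSort : (B : Set) → (B → Set) → Sort B → Set
interpSort B I natS      = ℕ
interpSort B I (baseS b) = I b

record Language : Set₁ where
  field
    BaseSort : Set
    baseI    : BaseSort → Set
    Fun      : List (Sort BaseSort) → Sort BaseSort → Set
    Rel      : List (Sort BaseSort) → Set
    funI     : ∀ {ss s} → Fun ss s →
               All (interpSort BaseSort baseI) ss → interpSort BaseSort baseI s
    relI     : ∀ {ss} → Rel ss → All (interpSort BaseSort baseI) ss → Set

module Syntax (L : Language) where
  open Language L

  Srt : Set
  Srt = Sort BaseSort

  ⟦_⟧ : Srt → Set
  ⟦_⟧ = interpSort BaseSort baseI

  Ctx : Set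
  Ctx = List Srt

  mutual
    data Term (Γ : Ctx) : Srt → Set where
      var  : ∀ {s} → s ∈ Γ → Term Γ s
      zeroT : Term Γ natS
      sucT : Term Γ natS → Term Γ natS
      app  : ∀ {ss s} → Fun ss s → Args Γ ss → Term Γ s

    data Args (Γ : Ctx) : List Srt → Set where
      []  : Args Γ []
      _∷_ : ∀ {s ss} → Term Γ s → Args Γ ss → Args Γ (s ∷ ss)

  data Formula (Γ : Ctx) : Set where
    rel     : ∀ {ss} → Rel ss → Args Γ ss → Formula Γ
    _≐_     : ∀ {s} → Term Γ s → Term Γ s → Formula Γ
    st      : ∀ {s} → Term Γ s → Formula Γ
    ⊤ᶠ ⊥ᶠ   : Formula Γ
    _∧ᶠ_ _∨ᶠ_ _⇒_ : Formula Γ → Formula Γ → Formula Γ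
    ∀ᶠ ∃ᶠ   : (s : Srt) → Formula (s ∷ Γ) → Formula Γ

  mutual
    renT : ∀ {Γ Δ s} → (∀ {t} → t ∈ Γ → t ∈ Δ) → Term Γ s → Term Δ s
    renT ρ (var x) = var (ρ x)
    renT ρ zeroT = zeroT
    renT ρ (sucT t) = sucT (renT ρ t)
    renT ρ (app f as) = app f (renA ρ as)

    renA : ∀ {Γ Δ ss} → (∀ {t} → t ∈ Γ → t ∈ Δ) → Args Γ ss → Args Δ ss
    renA ρ [] = []
    renA ρ (t ∷ as) = renT ρ t ∷ renA ρ as

  Sub : Ctx → Ctx → Set
  Sub Γ Δ = ∀ {t} → t ∈ Γ → Term Δ t

  liftSub : ∀ {Γ Δ s} → Sub Γ Δ → Sub (s ∷ Γ) (s ∷ Δ)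
  liftSub σ (here p) = var (here p)
  liftSub σ (there x) = renT there (σ x)

  mutual
    subT : ∀ {Γ Δ s} → Sub Γ Δ → Term Γ s → Term Δ s
    subT σ (var x) = σ x
    subT σ zeroT = zeroT
    subT σ (sucT t) = sucT (subT σ t)
    subT σ (app f as) = app f (subA σ as)

    subA : ∀ {Γ Δ ss} → Sub Γ Δ → Args Γ ss → Args Δ ss
    subA σ [] = []
    subA σ (t ∷ as) = subT σ t ∷ subA σ as

  subF : ∀ {Γ Δ} → Sub Γ Δ → Formula Γ → Formula Δ
  subF σ (rel R as) = rel R (subA σ as)
  subF σ (t ≐ u) = subT σ t ≐ subT σ u
  subF σ (st t) = st (subT σ t)
  subF σ ⊤ᶠ = ⊤ᶠ
  subF σ ⊥ᶠ = ⊥ᶠ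
  subF σ (φ ∧ᶠ ψ) = subF σ φ ∧ᶠ subF σ ψ
  subF σ (φ ∨ᶠ ψ) = subF σ φ ∨ᶠ subF σ ψ
  subF σ (φ ⇒ ψ) = subF σ φ ⇒ subF σ ψ
  subF σ (∀ᶠ s φ) = ∀ᶠ s (subF (liftSub σ) φ)
  subF σ (∃ᶠ s φ) = ∃ᶠ s (subF (liftSub σ) φ)

  instantiate : ∀ {Γ s} → Formula (s ∷ Γ) → Term Γ s → Formula Γ
  instantiate {Γ} {s} φ t = subF σ φ
    where
      σ : Sub (s ∷ Γ) Γ
      σ (here refl) = t
      σ (there x) = var x

  atSuc : ∀ {Γ} → Formula (natS ∷ Γ) → Formula (natS ∷ Γ)
  atSuc {Γ} φ = subF σ φ
    where
      σ : Sub (natS ∷ Γ) (natS ∷ Γ)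
      σ (here refl) = sucT (var (here refl))
      σ (there x) = var (there x)

  ∀ˢᵗ : ∀ {Γ} (s : Srt) → Formula (s ∷ Γ) → Formula Γ
  ∀ˢᵗ s φ = ∀ᶠ s (st (var (here refl)) ⇒ φ)

  closure : ∀ Γ → Formula Γ → Formula []
  closure [] φ = φ
  closure (s ∷ Γ) φ = closure Γ (∀ᶠ s φ)

  ExtInd : ∀ {Γ} → Formula (natS ∷ Γ) → Formula Γ
  ExtInd Φ = (instantiate Φ zeroT ∧ᶠ ∀ˢᵗ natS (Φ ⇒ atSuc Φ)) ⇒ ∀ˢᵗ natS Φ

  -- Interpretation in 𝓝 = Sh(𝔉Set, K): sorts S ↦ 𝐲S, symbols via
  -- Yoneda, st_S ↦ ΔS; truth via Kripke–Joyal (sheaf) semantics on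
  -- the site.

  Env : Obj → Ctx → Set
  Env F Γ = All (λ s → Elt F ⟦ s ⟧) Γ

  restrictEnv : ∀ {G F Γ} → Hom G F → Env F Γ → Env G Γ
  restrictEnv β ρ = All.map (restrict β) ρ

  mutual
    evalT : ∀ {F Γ s} → Term Γ s → Env F Γ → Elt F ⟦ s ⟧
    evalT (var x) ρ = All.lookup ρ x
    evalT zeroT ρ = constElt zero
    evalT (sucT t) ρ = mapElt suc (evalT t ρ)
    evalT (app f as) ρ = mapElt (funI f) (evalA as ρ)

    evalA : ∀ {F Γ ss} → Args Γ ss → Env F Γ → Elt F (All ⟦_⟧ ss)
    evalA [] ρ = constElt []
    evalA (t ∷ as) ρ = mapElt (λ p → proj₁ p ∷ proj₂ p) (pairElt (evalT t ρ) (evalA as ρ))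

  Forces : ∀ {Γ} → Formula Γ → (F : Obj) → Env F Γ → Set₁
  Forces (rel R as) F ρ = Level.Lift _ (InSub (relI R) (evalA as ρ))
  Forces (t ≐ u) F ρ = Level.Lift _ (EqElt (evalT t ρ) (evalT u ρ))
  Forces (st t) F ρ = Level.Lift _ (FinVal (evalT t ρ))
  Forces ⊤ᶠ F ρ = Level.Lift _ ⊤
  Forces ⊥ᶠ F ρ = Level.Lift _ (Covers {F} {0} (λ ()))
  Forces (φ ∧ᶠ ψ) F ρ = Forces φ F ρ × Forces ψ F ρ
  Forces (φ ∨ᶠ ψ) F ρ = Σ ℕ λ n → Σ (Family F n) λ fam → Covers fam ×
    ((k : Fin n) → Forces φ (proj₁ (fam k)) (restrictEnv (proj₂ (fam k)) ρ)
                 ⊎ Forces ψ (proj₁ (fam k)) (restrictEnv (proj₂ (fam k)) ρ))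
  Forces (φ ⇒ ψ) F ρ = (G : Obj) (β : Hom G F) →
    Forces φ G (restrictEnv β ρ) → Forces ψ G (restrictEnv β ρ)
  Forces (∀ᶠ s φ) F ρ = (G : Obj) (β : Hom G F) (b : Elt G ⟦ s ⟧) →
    Forces φ G (b ∷ restrictEnv β ρ)
  Forces (∃ᶠ s φ) F ρ = Σ ℕ λ n → Σ (Family F n) λ fam → Covers fam ×
    ((k : Fin n) → Σ (Elt (proj₁ (fam k)) ⟦ s ⟧) λ b →
       Forces φ (proj₁ (fam k)) (b ∷ restrictEnv (proj₂ (fam k)) ρ))

  Valid : Formula [] → Set₁
  Valid φ = Forces φ 𝟙 []

{-# OPTIONS --safe #-}
-- A standard n : ℕ at a stage K is locally bounded: on some base set of K it takes values below some N.
-- Induct on N.  For N = 0 that base set is empty, and an object with an empty base set forces everything.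
-- Otherwise split K into the subobjects where n = 0 and where n > 0.  On the first, Φ(n) is a restriction
-- of Φ(0).  On the second, n = S(n − 1) where n − 1 is standard and bounded by N − 1, so the induction
-- hypothesis and the step give Φ(n).  The two pieces cover a base set of K, and forcing is local for
-- such binary covers, so Φ(n) holds on all of K.
module Submission where

open import Defs
open import Level using (Lift; lift)
open import Data.Nat using (ℕ; zero; suc; _+_; _<_; pred; s≤s; z≤n; >-nonZero)
open import Data.Nat.Properties using (≡-irrelevant; <-irrelevant; m≤n⇒m<n∨m≡n; n≮0; suc-pred; pred-mono-<)
open import Data.Fin as Fin using (Fin; splitAt; _↑ˡ_; _↑ʳ_)
open import Data.Fin.Properties using (toℕ-fromℕ<; splitAt-↑ˡ; splitAt-↑ʳ)
open import Data.Product using (Σ; ∃; _×_; _,_; proj₁; proj₂)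
open import Data.Product.Function.NonDependent.Propositional using (_×-⇔_)
open import Data.Product.Function.Dependent.Propositional using (Σ-⇔)
open import Data.Sum as Sum using (_⊎_; [_,_])
open import Data.Sum.Function.Propositional using (_⊎-⇔_)
open import Data.Empty using (⊥; ⊥-elim)
open import Data.Unit using (⊤; tt)
open import Data.List as List using ([]; _∷_)
open import Data.List.Extrema.Nat using (max; xs≤max)
open import Data.List.Membership.Propositional using (_∈_)
open import Data.List.Membership.Propositional.Properties using (∈-tabulate⁺)
open import Data.List.Relation.Unary.Any using (here; there)
open import Data.List.Relation.Unary.All as All using (All; []; _∷_)
open import Data.List.Relation.Unary.All.Properties using (lookup-map)
open import Function.Base using (_∘_)
open import Function.Bundles using (_⇔_; mk⇔; Equivalence)
open import Function.Construct.Identity using (⇔-id; ↠-id)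
open import Function.Construct.Composition using (_⇔-∘_)
open import Function.Related.TypeIsomorphisms using (→-cong-⇔)
open import Relation.Nullary using (Irrelevant)
open import Relation.Binary.PropositionalEquality using (_≡_; refl; sym; trans; cong; cong₂; subst)

Π-⇔ : ∀ {a b c} {A : Set a} {B : A → Set b} {C : A → Set c} →
      (∀ x → B x ⇔ C x) → ((x : A) → B x) ⇔ ((x : A) → C x)
Π-⇔ e = mk⇔ (λ f x → Equivalence.to (e x) (f x)) (λ g x → Equivalence.from (e x) (g x))

Lift-⇔ : ∀ {a b ℓ} {A : Set a} {B : Set b} → A ⇔ B → Lift ℓ A ⇔ Lift ℓ B
Lift-⇔ e = mk⇔ (λ (lift x) → lift (Equivalence.to e x)) (λ (lift y) → lift (Equivalence.from e y))

×-irrelevant : ∀ {A B : Set} → Irrelevant A → Irrelevant B → Irrelevant (A × B)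
×-irrelevant irrA irrB (a , b) (a′ , b′) = cong₂ _,_ (irrA a a′) (irrB b b′)

Σ-irrelevant : ∀ {A : Set} {B : A → Set} → Irrelevant A → (∀ a → Irrelevant (B a)) → Irrelevant (Σ A B)
Σ-irrelevant irrA irrB (a , b) (a′ , b′) with irrA a a′
... | refl = cong (a ,_) (irrB a b b′)

meet : (F : Obj) → Idx F → Idx F → Idx F
meet F i j = proj₁ (dir F i j)

meet⊆ˡ : (F : Obj) {i j : Idx F} {x : Car F} → base F (meet F i j) x → base F i x
meet⊆ˡ F {i} {j} {x} p = proj₁ (proj₂ (dir F i j) x p)

meet⊆ʳ : (F : Obj) {i j : Idx F} {x : Car F} → base F (meet F i j) x → base F j x
meet⊆ʳ F {i} {j} {x} p = proj₂ (proj₂ (dir F i j) x p)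

-- By unfolding, InSub R a = Eventually F (a ⁻¹⟨ R ⟩), EqElt a b = Eventually F (Agree a b),
-- Covers fam ch = Eventually F (Hit fam ch) and cont β i = Eventually G (β ⁻¹[ base F i ]);
-- the lemmas below are applied to these without conversion.
Eventually : (F : Obj) → (Car F → Set) → Set
Eventually F R = Σ (Idx F) λ i → ∀ x → base F i x → R x

eventually-base : (F : Obj) (i : Idx F) → Eventually F (base F i)
eventually-base F i = i , λ _ p → p

eventually-map : ∀ {F} {R R′ : Car F → Set} → (∀ {x} → R x → R′ x) → Eventually F R → Eventually F R′
eventually-map f (i , h) = i , λ x p → f (h x p)

eventually-zip : ∀ {F} {R R′ R″ : Car F → Set} → (∀ {x} → R x → R′ x → R″ x) →
                 Eventually F R → Eventually F R′ → Eventually F R″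
eventually-zip {F} f (i , h) (j , h′) = meet F i j , λ x p → f (h x (meet⊆ˡ F p)) (h′ x (meet⊆ʳ F p))

eventually-all : ∀ {F n} {R : Fin n → Car F → Set} →
                 (∀ k → Eventually F (R k)) → Eventually F (λ x → ∀ k → R k x)
eventually-all {F} {zero}  h = inh F , λ _ _ ()
eventually-all {F} {suc n} h = eventually-zip {F} (λ r rs → λ { Fin.zero → r ; (Fin.suc k) → rs k })
  (h Fin.zero) (eventually-all {F} (λ k → h (Fin.suc k)))

_⁻¹[_] : ∀ {G F} → Hom G F → (Car F → Set) → Car G → Set
_⁻¹[_] {G} β R y = Σ (base G (dom β) y) λ q → R (fun β y q)

_⁻¹⟨_⟩ : ∀ {F S} → Elt F S → (S → Set) → Car F → Set
_⁻¹⟨_⟩ {F} a R x = Σ (base F (edom a) x) λ q → R (val a x q)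

fun-cong : ∀ {G F} (β : Hom G F) {y y′} → y ≡ y′ →
           (q : base G (dom β) y) (q′ : base G (dom β) y′) → fun β y q ≡ fun β y′ q′
fun-cong {G} β {y} refl q q′ = cong (fun β y) (baseProp G (dom β) y q q′)

val-cong : ∀ {F S} (a : Elt F S) {x x′} → x ≡ x′ →
           (q : base F (edom a) x) (q′ : base F (edom a) x′) → val a x q ≡ val a x′ q′
val-cong {F} a {x} refl q q′ = cong (val a x) (baseProp F (edom a) x q q′)

eventually-pull : ∀ {G F} {R : Car F → Set} (β : Hom G F) → Eventually F R → Eventually G (β ⁻¹[ R ])
eventually-pull {G} β (i , h) = eventually-map {G} (λ (q , p) → q , h _ p) (cont β i)

idʰ : ∀ {F} → Hom F F
idʰ {F} = record
  { dom = inh F ; fun = λ x _ → x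
  ; cont = λ i → eventually-zip {F} (λ p q → p , q) (eventually-base F (inh F)) (eventually-base F i) }

infixr 9 _∘ʰ_
_∘ʰ_ : ∀ {H G F} → Hom G F → Hom H G → Hom H F
_∘ʰ_ {H} {G} {F} β γ = record { dom = proj₁ γ⁻¹dom ; fun = f ; cont = continuous }
  where
  γ⁻¹dom : Eventually H (γ ⁻¹[ base G (dom β) ])
  γ⁻¹dom = cont γ (dom β)
  f : (y : Car H) → base H (proj₁ γ⁻¹dom) y → Car F
  f y p = let (q , r) = proj₂ γ⁻¹dom y p in fun β (fun γ y q) r
  continuous : ∀ i → Eventually H (λ y → Σ (base H (proj₁ γ⁻¹dom) y) λ p → base F i (f y p))
  continuous i = eventually-zip {H}
    (λ p (q , r , b) → p , subst (base F i) (fun-cong β (fun-cong γ refl q _) r _) b)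
    (eventually-base H (proj₁ γ⁻¹dom)) (eventually-pull γ (cont β i))

Agree : ∀ {F S} → Elt F S → Elt F S → Car F → Set
Agree {F} a b x = Σ (base F (edom a) x) λ q → Σ (base F (edom b) x) λ r → val a x q ≡ val b x r

bothDefined : ∀ {F S T} (a : Elt F S) (b : Elt F T) →
              Eventually F (λ x → base F (edom a) x × base F (edom b) x)
bothDefined {F} a b = eventually-zip {F} _,_ (eventually-base F (edom a)) (eventually-base F (edom b))

-- EqElt a b, wrapped in a record so that a and b can be inferred from it.
infix 4 _≈_
record _≈_ {F : Obj} {S : Set} (a b : Elt F S) : Set where
  constructor mk≈
  field agree : Eventually F (Agree a b)
open _≈_

Image : ∀ {n S} → (Fin n → S) → S → Set
Image {n} v s = Σ (Fin n) λ m → s ≡ v m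

module _ {F : Obj} {S : Set} where

  ≈-pointwise : {a b : Elt F S} →
                (∀ {x} (q : base F (edom a) x) (r : base F (edom b) x) → val a x q ≡ val b x r) → a ≈ b
  ≈-pointwise {a} {b} h = mk≈ (eventually-map {F} (λ (q , r) → q , r , h q r) (bothDefined a b))

  ≈-refl : {a : Elt F S} → a ≈ a
  ≈-refl {a} = ≈-pointwise (val-cong a refl)

  ≈-reflexive : {a b : Elt F S} → a ≡ b → a ≈ b
  ≈-reflexive refl = ≈-refl

  ≈-sym : {a b : Elt F S} → a ≈ b → b ≈ a
  ≈-sym (mk≈ E) = mk≈ (eventually-map {F} (λ (q , r , e) → r , q , sym e) E)

  ≈-trans : {a b c : Elt F S} → a ≈ b → b ≈ c → a ≈ c
  ≈-trans {b = b} (mk≈ E) (mk≈ E′) = mk≈ (eventually-zip {F}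
    (λ (q , r , e) (r′ , s , e′) → q , s , trans e (trans (val-cong b refl r r′) e′)) E E′)

  InSub-map : {R R′ : S → Set} (a : Elt F S) → (∀ {s} → R s → R′ s) → InSub R a → InSub R′ a
  InSub-map a f = eventually-map {F} (λ (q , h) → q , f h)

  InSub-zip : {R R′ R″ : S → Set} (a : Elt F S) → (∀ {s} → R s → R′ s → R″ s) →
              InSub R a → InSub R′ a → InSub R″ a
  InSub-zip {R′ = R′} a f = eventually-zip {F} (λ (q , h) (q′ , h′) → q , f h (subst R′ (val-cong a refl q′ q) h′))

  InSub-resp-≈ : (R : S → Set) {a b : Elt F S} → a ≈ b → InSub R a → InSub R b
  InSub-resp-≈ R {a} (mk≈ E) = eventually-zip {F}
    (λ (q , r , e) (q′ , h) → r , subst R (trans (val-cong a refl q′ q) e) h) E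

  FinVal-resp-≈ : {a b : Elt F S} → a ≈ b → FinVal a → FinVal b
  FinVal-resp-≈ E (k , n , v , h) = let (k′ , h′) = InSub-resp-≈ (Image v) E (k , h) in k′ , n , v , h′

  InSub-cong : (R : S → Set) {a b : Elt F S} → a ≈ b → InSub R a ⇔ InSub R b
  InSub-cong R E = mk⇔ (InSub-resp-≈ R E) (InSub-resp-≈ R (≈-sym E))

  FinVal-cong : {a b : Elt F S} → a ≈ b → FinVal a ⇔ FinVal b
  FinVal-cong E = mk⇔ (FinVal-resp-≈ E) (FinVal-resp-≈ (≈-sym E))

  EqElt-cong : {a a′ b b′ : Elt F S} → a ≈ a′ → b ≈ b′ → EqElt a b ⇔ EqElt a′ b′
  EqElt-cong A B = mk⇔ (λ h → agree (≈-trans (≈-sym A) (≈-trans (mk≈ h) B)))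
                       (λ h → agree (≈-trans A (≈-trans (mk≈ h) (≈-sym B))))

module _ {G F : Obj} (β : Hom G F) {S : Set} where

  InSub-restrict⁺ : (R : S → Set) (a : Elt F S) → Eventually G (β ⁻¹[ a ⁻¹⟨ R ⟩ ]) → InSub R (restrict β a)
  InSub-restrict⁺ R a = eventually-zip {G}
    (λ p (q , r , h) → p , subst R (val-cong a (fun-cong β refl q _) r _) h)
    (eventually-base G (edom (restrict β a)))

  InSub-restrict⁻ : (R : S → Set) (a : Elt F S) → InSub R (restrict β a) → Eventually G (β ⁻¹[ a ⁻¹⟨ R ⟩ ])
  InSub-restrict⁻ R a = eventually-map {G} λ {y} (p , h) → let (q , r) = proj₂ (cont β (edom a)) y p in q , r , h

  InSub-restrict : (R : S → Set) (a : Elt F S) → InSub R a → InSub R (restrict β a)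
  InSub-restrict R a h = InSub-restrict⁺ R a (eventually-pull β h)

  FinVal-restrict : {a : Elt F S} → FinVal a → FinVal (restrict β a)
  FinVal-restrict {a} (k , n , v , h) = let (k′ , h′) = InSub-restrict (Image v) a (k , h) in k′ , n , v , h′

  restrict-cong : {a b : Elt F S} → a ≈ b → restrict β a ≈ restrict β b
  restrict-cong {a} {b} (mk≈ E) = mk≈ (eventually-zip {G}
    (λ (pa , pb) (q , r , r′ , e) →
       pa , pb , trans (val-cong a (fun-cong β refl _ q) _ r) (trans e (val-cong b (fun-cong β refl q _) r′ _)))
    (bothDefined (restrict β a) (restrict β b)) (eventually-pull β E))

  restrict-const : (s : S) → restrict β (constElt s) ≈ constElt s
  restrict-const s = ≈-pointwise λ _ _ → refl

  restrict-pair : ∀ {T} (a : Elt F S) (b : Elt F T) →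
                  restrict β (pairElt a b) ≈ pairElt (restrict β a) (restrict β b)
  restrict-pair a b = ≈-pointwise λ _ _ →
    cong₂ _,_ (val-cong a (fun-cong β refl _ _) _ _) (val-cong b (fun-cong β refl _ _) _ _)

  restrict-∘ : ∀ {H} (γ : Hom H G) (a : Elt F S) → restrict (β ∘ʰ γ) a ≈ restrict γ (restrict β a)
  restrict-∘ γ a = ≈-pointwise λ _ _ → val-cong a (fun-cong β (fun-cong γ refl _ _) _ _) _ _

restrict-id : ∀ {F S} (a : Elt F S) → restrict idʰ a ≈ a
restrict-id a = ≈-pointwise λ _ _ → val-cong a refl _ _

module _ {F : Obj} {S T : Set} where

  mapElt-cong : (f : S → T) {a b : Elt F S} → a ≈ b → mapElt f a ≈ mapElt f b
  mapElt-cong f (mk≈ E) = mk≈ (eventually-map {F} (λ (q , r , e) → q , r , cong f e) E)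

  pairElt-cong : {a a′ : Elt F S} {b b′ : Elt F T} → a ≈ a′ → b ≈ b′ → pairElt a b ≈ pairElt a′ b′
  pairElt-cong {a} {a′} {b} {b′} (mk≈ E) (mk≈ E′) = mk≈ (eventually-zip {F}
    (λ (p , p′) ((qa , qa′ , ea) , (qb , qb′ , eb)) →
       p , p′ , cong₂ _,_ (trans (val-cong a refl _ qa) (trans ea (val-cong a′ refl qa′ _)))
                          (trans (val-cong b refl _ qb) (trans eb (val-cong b′ refl qb′ _))))
    (bothDefined (pairElt a b) (pairElt a′ b′)) (eventually-zip {F} _,_ E E′))

Empty : Obj → Set
Empty F = Eventually F (λ _ → ⊥)

Empty-restrict : ∀ {G F} (β : Hom G F) → Empty F → Empty G
Empty-restrict {G} β e = eventually-map {G} proj₂ (eventually-pull β e)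

-- Covering families

Choice : ∀ {F n} → Family F n → Set
Choice {n = n} fam = (k : Fin n) → Idx (proj₁ (fam k))

Hit : ∀ {F n} (fam : Family F n) → Choice fam → Car F → Set
Hit {n = n} fam ch x =
  Σ (Fin n) λ k → Σ (Car (proj₁ (fam k))) λ y →
    Σ (base (proj₁ (fam k)) (ch k) y) λ _ → (proj₂ (fam k) ⁻¹[ _≡ x ]) y

Locally : (F : Obj) → (Σ Obj (λ G → Hom G F) → Set₁) → Set₁
Locally F Holds = Σ ℕ λ n → Σ (Family F n) λ fam → Covers fam × ((k : Fin n) → Holds (fam k))

Locally-empty : ∀ {F} (Holds : Σ Obj (λ G → Hom G F) → Set₁) → Empty F → Locally F Holds
Locally-empty Holds (i , h) = 0 , (λ ()) , (λ _ → i , λ x p → ⊥-elim (h x p)) , λ ()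

module Pullback {A G F : Obj} (α : Hom A F) (β : Hom G F) where

  obj : Obj
  obj = record
    { Car = Σ (Car A) λ y → Σ (Car G) λ x → Σ (base A (dom α) y) λ qa → (β ⁻¹[ fun α y qa ≡_ ]) x
    ; Idx = Idx A × Idx G
    ; base = λ (i , j) (y , x , _) → base A i y × base G j x
    ; baseProp = λ (i , j) (y , x , _) → ×-irrelevant (baseProp A i y) (baseProp G j x)
    ; inh = inh A , inh G
    ; dir = λ (i , j) (i′ , j′) → (meet A i i′ , meet G j j′) ,
              λ _ (p , q) → (meet⊆ˡ A p , meet⊆ˡ G q) , (meet⊆ʳ A p , meet⊆ʳ G q) }

  π₁ : Hom obj A
  π₁ = record { dom = dom α , dom β ; fun = λ (y , _) _ → y
              ; cont = λ i → (meet A (dom α) i , dom β) , λ _ (p , q) → (meet⊆ˡ A p , q) , meet⊆ʳ A p }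

  π₂ : Hom obj G
  π₂ = record { dom = dom α , dom β ; fun = λ (_ , x , _) _ → x
              ; cont = λ j → (dom α , meet G (dom β) j) , λ _ (p , q) → (p , meet⊆ˡ G q) , meet⊆ʳ G q }

  square : ∀ {S} (a : Elt F S) → restrict π₁ (restrict α a) ≈ restrict π₂ (restrict β a)
  square a = ≈-pointwise λ { {y , x , qa , qg , e} _ _ →
    val-cong a (trans (fun-cong α refl _ qa) (trans e (fun-cong β refl qg _))) _ _ }

pullbackFamily : ∀ {G F n} → Family F n → Hom G F → Family G n
pullbackFamily fam β k = Pullback.obj (proj₂ (fam k)) β , Pullback.π₂ (proj₂ (fam k)) β

pullback-Covers : ∀ {G F n} (fam : Family F n) (β : Hom G F) → Covers fam → Covers (pullbackFamily fam β)
pullback-Covers {G} fam β cov ch = eventually-zip {G}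
  (λ {x} (qg , k , y , u , qa , e) chosen → k , (y , x , qa , qg , e) , (u , chosen k) , (qa , qg) , refl)
  (eventually-pull β (cov (λ k → proj₁ (ch k))))
  (eventually-all {G} (λ k → eventually-base G (proj₂ (ch k))))

-- Recursion on the left length, rather than splitAt, keeps the components of a joined family
-- definitionally those of its parts, so choices and hits transfer without transport.
infixr 5 _++ᶠ_
_++ᶠ_ : ∀ {F m n} → Family F m → Family F n → Family F (m + n)
_++ᶠ_ {m = zero}  fl fr = fr
_++ᶠ_ {m = suc m} fl fr Fin.zero    = fl Fin.zero
_++ᶠ_ {m = suc m} fl fr (Fin.suc k) = ((λ k → fl (Fin.suc k)) ++ᶠ fr) k

module _ {F : Obj} where

  ++ᶠ-all : ∀ {m n} (fl : Family F m) (fr : Family F n) (Holds : Σ Obj (λ G → Hom G F) → Set₁) →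
            (∀ k → Holds (fl k)) → (∀ k → Holds (fr k)) → ∀ k → Holds ((fl ++ᶠ fr) k)
  ++ᶠ-all {zero}  fl fr Holds hl hr k           = hr k
  ++ᶠ-all {suc m} fl fr Holds hl hr Fin.zero    = hl Fin.zero
  ++ᶠ-all {suc m} fl fr Holds hl hr (Fin.suc k) =
    ++ᶠ-all (λ k → fl (Fin.suc k)) fr Holds (λ k → hl (Fin.suc k)) hr k

  choiceˡ : ∀ {m n} (fl : Family F m) (fr : Family F n) → Choice (fl ++ᶠ fr) → Choice fl
  choiceˡ {suc m} fl fr ch Fin.zero    = ch Fin.zero
  choiceˡ {suc m} fl fr ch (Fin.suc k) = choiceˡ (λ k → fl (Fin.suc k)) fr (λ k → ch (Fin.suc k)) k

  choiceʳ : ∀ {m n} (fl : Family F m) (fr : Family F n) → Choice (fl ++ᶠ fr) → Choice fr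
  choiceʳ {zero}  fl fr ch = ch
  choiceʳ {suc m} fl fr ch = choiceʳ (λ k → fl (Fin.suc k)) fr (λ k → ch (Fin.suc k))

  hitˡ : ∀ {m n} (fl : Family F m) (fr : Family F n) (ch : Choice (fl ++ᶠ fr)) {x} →
         Hit fl (choiceˡ fl fr ch) x → Hit (fl ++ᶠ fr) ch x
  hitˡ {suc m} fl fr ch (Fin.zero , h)  = Fin.zero , h
  hitˡ {suc m} fl fr ch (Fin.suc k , h) =
    let (k′ , h′) = hitˡ (λ k → fl (Fin.suc k)) fr (λ k → ch (Fin.suc k)) (k , h) in Fin.suc k′ , h′

  hitʳ : ∀ {m n} (fl : Family F m) (fr : Family F n) (ch : Choice (fl ++ᶠ fr)) {x} →
         Hit fr (choiceʳ fl fr ch) x → Hit (fl ++ᶠ fr) ch x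
  hitʳ {zero}  fl fr ch h = h
  hitʳ {suc m} fl fr ch h =
    let (k′ , h′) = hitʳ (λ k → fl (Fin.suc k)) fr (λ k → ch (Fin.suc k)) h in Fin.suc k′ , h′

-- Subobjects and binary covers

record Subset (F : Obj) : Set₁ where
  field
    holds            : Car F → Set
    holds-irrelevant : ∀ x → Irrelevant (holds x)
open Subset

_↾_ : (F : Obj) → Subset F → Obj
F ↾ P = record
  { Car = Car F ; Idx = Idx F
  ; base = λ i x → base F i x × holds P x
  ; baseProp = λ i x → ×-irrelevant (baseProp F i x) (holds-irrelevant P x)
  ; inh = inh F
  ; dir = λ i j → meet F i j , λ x (p , h) → (meet⊆ˡ F p , h) , (meet⊆ʳ F p , h) }

eventually-↾ : ∀ {F} (P : Subset F) {R : Car F → Set} → Eventually F R → Eventually (F ↾ P) R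
eventually-↾ P (i , h) = i , λ x (p , _) → h x p

incl : ∀ {F} (P : Subset F) → Hom (F ↾ P) F
incl {F} P = record
  { dom = inh F ; fun = λ x _ → x
  ; cont = λ i → eventually-zip {F ↾ P} (λ q (p , _) → q , p)
                   (eventually-base (F ↾ P) (inh F)) (eventually-base (F ↾ P) i) }

widen : ∀ {H F} {P : Subset F} → Hom H (F ↾ P) → Hom H F
widen {H} β = record
  { dom = dom β ; fun = fun β ; cont = λ i → eventually-map {H} (λ (q , p , _) → q , p) (cont β i) }

restrict-widen : ∀ {H F S} {P : Subset F} (β : Hom H (F ↾ P)) (a : Elt F S) →
                 restrict β (restrict (incl P) a) ≈ restrict (widen β) a
restrict-widen β a = ≈-pointwise λ _ _ → val-cong a (fun-cong β refl _ _) _ _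

widenFamily : ∀ {F n} (P : Subset F) → Family (F ↾ P) n → Family F n
widenFamily P fam k = proj₁ (fam k) , widen (proj₂ (fam k))

pullSubset : ∀ {G F} → Hom G F → Subset F → Subset G
pullSubset {G} β P = record
  { holds = β ⁻¹[ holds P ]
  ; holds-irrelevant = λ y → Σ-irrelevant (baseProp G (dom β) y) (λ q → holds-irrelevant P (fun β y q)) }

_↾ʰ_ : ∀ {G F} (β : Hom G F) (P : Subset F) → Hom (G ↾ pullSubset β P) (F ↾ P)
_↾ʰ_ {G} {F} β P = record { dom = dom β ; fun = λ y (q , _) → fun β y q ; cont = continuous }
  where
  continuous : ∀ i → Eventually (G ↾ pullSubset β P) λ y →
    Σ (base G (dom β) y × (β ⁻¹[ holds P ]) y) λ (q , _) → base F i (fun β y q) × holds P (fun β y q)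
  continuous i = eventually-zip {G ↾ pullSubset β P}
    (λ (q , b) (q′ , q″ , h) →
       (q′ , q″ , h) , subst (base F i) (fun-cong β refl q q′) b , subst (holds P) (fun-cong β refl q″ q′) h)
    (eventually-↾ (pullSubset β P) (cont β i)) (eventually-base (G ↾ pullSubset β P) (dom β))

↾-square : ∀ {G F S} (β : Hom G F) (P : Subset F) (a : Elt F S) →
           restrict (β ↾ʰ P) (restrict (incl P) a) ≈ restrict (incl (pullSubset β P)) (restrict β a)
↾-square β P a = ≈-pointwise λ _ _ → val-cong a (fun-cong β refl _ _) _ _

record BinaryCover (F : Obj) : Set₁ where
  field
    left right : Subset F
    covered    : Eventually F (λ x → holds left x ⊎ holds right x)
open BinaryCover

pullCover : ∀ {G F} → Hom G F → BinaryCover F → BinaryCover G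
pullCover {G} β C = record
  { left = pullSubset β (left C) ; right = pullSubset β (right C)
  ; covered = eventually-map {G} (λ (q , h) → Sum.map (q ,_) (q ,_) h) (eventually-pull β (covered C)) }

module Glue {F : Obj} (C : BinaryCover F) where

  eventually-glue : {R : Car F → Set} → Eventually (F ↾ left C) R → Eventually (F ↾ right C) R → Eventually F R
  eventually-glue (i , hl) (j , hr) = eventually-zip {F}
    (λ (p , q) → [ (λ l → hl _ (p , l)) , (λ r → hr _ (q , r)) ])
    (eventually-zip {F} _,_ (eventually-base F i) (eventually-base F j)) (covered C)

  Covers-glue : ∀ {m n} (fl : Family (F ↾ left C) m) (fr : Family (F ↾ right C) n) → Covers fl → Covers fr →
                Covers (widenFamily (left C) fl ++ᶠ widenFamily (right C) fr)
  Covers-glue fl fr cl cr ch = eventually-glue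
    (eventually-map {F ↾ left C} (hitˡ fl′ fr′ ch) (cl (choiceˡ fl′ fr′ ch)))
    (eventually-map {F ↾ right C} (hitʳ fl′ fr′ ch) (cr (choiceʳ fl′ fr′ ch)))
    where
    fl′ = widenFamily (left C) fl
    fr′ = widenFamily (right C) fr

  Locally-glue : {Hl : Σ Obj (λ G → Hom G (F ↾ left C)) → Set₁} {Hr : Σ Obj (λ G → Hom G (F ↾ right C)) → Set₁}
                 (Holds : Σ Obj (λ G → Hom G F) → Set₁) →
                 (∀ {G} (β : Hom G (F ↾ left C)) → Hl (G , β) → Holds (G , widen β)) →
                 (∀ {G} (β : Hom G (F ↾ right C)) → Hr (G , β) → Holds (G , widen β)) →
                 Locally (F ↾ left C) Hl → Locally (F ↾ right C) Hr → Locally F Holds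
  Locally-glue Holds fromˡ fromʳ (nl , fl , cl , hl) (nr , fr , cr , hr) =
    nl + nr , widenFamily (left C) fl ++ᶠ widenFamily (right C) fr , Covers-glue fl fr cl cr ,
    ++ᶠ-all _ _ Holds (λ k → fromˡ (proj₂ (fl k)) (hl k)) (λ k → fromʳ (proj₂ (fr k)) (hr k))

  module _ {S : Set} where

    InSub-glue : (R : S → Set) (a : Elt F S) →
                 InSub R (restrict (incl (left C)) a) → InSub R (restrict (incl (right C)) a) → InSub R a
    InSub-glue R a hl hr = eventually-glue
      (eventually-map {F ↾ left C} proj₂ (InSub-restrict⁻ (incl (left C)) R a hl))
      (eventually-map {F ↾ right C} proj₂ (InSub-restrict⁻ (incl (right C)) R a hr))

    ≈-glue : {a b : Elt F S} →
             restrict (incl (left C)) a ≈ restrict (incl (left C)) b →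
             restrict (incl (right C)) a ≈ restrict (incl (right C)) b → a ≈ b
    ≈-glue {a} {b} (mk≈ El) (mk≈ Er) = mk≈ (eventually-glue (unrestrict (left C) El) (unrestrict (right C) Er))
      where
      unrestrict : ∀ P → Eventually (F ↾ P) (Agree (restrict (incl P) a) (restrict (incl P) b)) →
                   Eventually (F ↾ P) (Agree a b)
      unrestrict P = eventually-map {F ↾ P} λ {x} (p , p′ , e) →
        proj₂ (proj₂ (cont (incl P) (edom a)) x p) , proj₂ (proj₂ (cont (incl P) (edom b)) x p′) , e

    FinVal-glue : (a : Elt F S) →
                  FinVal (restrict (incl (left C)) a) → FinVal (restrict (incl (right C)) a) → FinVal a
    FinVal-glue a (kl , nl , vl , hl) (kr , nr , vr , hr) =
      let (k , h) = InSub-glue (Image v) a (InSub-map {R = Image vl} aˡ embedˡ (kl , hl))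
                                           (InSub-map {R = Image vr} aʳ embedʳ (kr , hr))
      in k , nl + nr , v , h
      where
      aˡ = restrict (incl (left C)) a
      aʳ = restrict (incl (right C)) a
      v : Fin (nl + nr) → S
      v m = [ vl , vr ] (splitAt nl m)
      embedˡ : ∀ {s} → Image vl s → Image v s
      embedˡ (m , e) = m ↑ˡ nr , trans e (sym (cong [ vl , vr ] (splitAt-↑ˡ nl m nr)))
      embedʳ : ∀ {s} → Image vr s → Image v s
      embedʳ (m , e) = nl ↑ʳ m , trans e (sym (cong [ vl , vr ] (splitAt-↑ʳ nl nr m)))

preimageSubset : ∀ {F S} (a : Elt F S) (R : S → Set) → (∀ s → Irrelevant (R s)) → Subset F
preimageSubset {F} a R irr = record
  { holds = a ⁻¹⟨ R ⟩
  ; holds-irrelevant = λ x → Σ-irrelevant (baseProp F (edom a) x) (λ q → irr (val a x q)) }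

InSub-on-preimage : ∀ {F S} (a : Elt F S) (R : S → Set) (irr : ∀ s → Irrelevant (R s)) →
                    InSub R (restrict (incl (preimageSubset a R irr)) a)
InSub-on-preimage {F} a R irr =
  InSub-restrict⁺ (incl (preimageSubset a R irr)) R a (inh F , λ _ (p , h) → (p , h) , h)

preimageCover : ∀ {F S} (a : Elt F S) (R R′ : S → Set) → (∀ s → Irrelevant (R s)) → (∀ s → Irrelevant (R′ s)) →
                (∀ s → R s ⊎ R′ s) → BinaryCover F
preimageCover {F} a R R′ irr irr′ split = record
  { left = preimageSubset a R irr ; right = preimageSubset a R′ irr′
  ; covered = eventually-map {F} (λ q → Sum.map (q ,_) (q ,_) (split (val a _ q))) (eventually-base F (edom a)) }

const-≈ : ∀ {F S} {s : S} (a : Elt F S) → InSub (s ≡_) a → constElt s ≈ a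
const-≈ {F} a h = mk≈ (eventually-zip {F} (λ i (q , e) → i , q , e) (eventually-base F (inh F)) h)

suc-pred-≈ : ∀ {F} (a : Elt F ℕ) → InSub (0 <_) a → mapElt suc (mapElt pred a) ≈ a
suc-pred-≈ {F} a h = mk≈ (eventually-map {F} (λ (q , pos) → q , q , suc-pred (val a _ q) {{>-nonZero pos}}) h)

bounded⇒FinVal : ∀ {F} N (c : Elt F ℕ) → InSub (_< N) c → FinVal c
bounded⇒FinVal N c (k , h) =
  k , N , Fin.toℕ , λ x p → let (q , lt) = h x p in q , Fin.fromℕ< lt , sym (toℕ-fromℕ< lt)

FinVal⇒bounded : ∀ {F} (c : Elt F ℕ) → FinVal c → ∃ λ N → InSub (_< N) c
FinVal⇒bounded c (k , n , v , h) = suc (max 0 (List.tabulate v)) , InSub-map {R = Image v} c below-max (k , h)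
  where
  below-max : ∀ {s} → Image v s → s < suc (max 0 (List.tabulate v))
  below-max (m , refl) = s≤s (All.lookup (xs≤max 0 (List.tabulate v)) (∈-tabulate⁺ m))

-- Forcing

module Semantics (L : Language) where
  open Language L
  open Syntax L

  infix 4 _≋_
  _≋_ : ∀ {F Γ} → Env F Γ → Env F Γ → Set
  [] ≋ [] = ⊤
  (a ∷ ρ) ≋ (b ∷ ρ′) = a ≈ b × ρ ≋ ρ′

  ≋-sym : ∀ {F Γ} {ρ ρ′ : Env F Γ} → ρ ≋ ρ′ → ρ′ ≋ ρ
  ≋-sym {ρ = []}    {[]}     _        = tt
  ≋-sym {ρ = _ ∷ _} {_ ∷ _} (e , es) = ≈-sym e , ≋-sym es

  ≋-trans : ∀ {F Γ} {ρ ρ′ ρ″ : Env F Γ} → ρ ≋ ρ′ → ρ′ ≋ ρ″ → ρ ≋ ρ″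
  ≋-trans {ρ = []}    {[]}    {[]}     _        _          = tt
  ≋-trans {ρ = _ ∷ _} {_ ∷ _} {_ ∷ _} (e , es) (e′ , es′) = ≈-trans e e′ , ≋-trans es es′

  lookup-≋ : ∀ {F Γ s} {ρ ρ′ : Env F Γ} → ρ ≋ ρ′ → (x : s ∈ Γ) → All.lookup ρ x ≈ All.lookup ρ′ x
  lookup-≋ {ρ = _ ∷ _} {_ ∷ _} (e , _)  (here refl) = e
  lookup-≋ {ρ = _ ∷ _} {_ ∷ _} (_ , es) (there x)   = lookup-≋ es x

  module _ {G F : Obj} (β : Hom G F) where

    restrictEnv-cong : ∀ {Γ} {ρ ρ′ : Env F Γ} → ρ ≋ ρ′ → restrictEnv β ρ ≋ restrictEnv β ρ′
    restrictEnv-cong {ρ = []}    {[]}     _        = tt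
    restrictEnv-cong {ρ = _ ∷ _} {_ ∷ _} (e , es) = restrict-cong β e , restrictEnv-cong es

    restrictEnv-∘ : ∀ {H Γ} (γ : Hom H G) (ρ : Env F Γ) → restrictEnv (β ∘ʰ γ) ρ ≋ restrictEnv γ (restrictEnv β ρ)
    restrictEnv-∘ γ []      = tt
    restrictEnv-∘ γ (a ∷ ρ) = restrict-∘ β γ a , restrictEnv-∘ γ ρ

    restrictEnv-↾-square : ∀ {Γ} (P : Subset F) (ρ : Env F Γ) →
      restrictEnv (β ↾ʰ P) (restrictEnv (incl P) ρ) ≋ restrictEnv (incl (pullSubset β P)) (restrictEnv β ρ)
    restrictEnv-↾-square P []      = tt
    restrictEnv-↾-square P (a ∷ ρ) = ↾-square β P a , restrictEnv-↾-square P ρ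

  restrictEnv-id : ∀ {F Γ} (ρ : Env F Γ) → restrictEnv idʰ ρ ≋ ρ
  restrictEnv-id []      = tt
  restrictEnv-id (a ∷ ρ) = restrict-id a , restrictEnv-id ρ

  restrictEnv-widen : ∀ {H F Γ} {P : Subset F} (β : Hom H (F ↾ P)) (ρ : Env F Γ) →
                      restrictEnv β (restrictEnv (incl P) ρ) ≋ restrictEnv (widen β) ρ
  restrictEnv-widen β []      = tt
  restrictEnv-widen β (a ∷ ρ) = restrict-widen β a , restrictEnv-widen β ρ

  restrictEnv-pullback-square : ∀ {A G F Γ} (α : Hom A F) (β : Hom G F) (ρ : Env F Γ) →
    restrictEnv (Pullback.π₁ α β) (restrictEnv α ρ) ≋ restrictEnv (Pullback.π₂ α β) (restrictEnv β ρ)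
  restrictEnv-pullback-square α β []      = tt
  restrictEnv-pullback-square α β (a ∷ ρ) = Pullback.square α β a , restrictEnv-pullback-square α β ρ

  private
    cons : ∀ {s ss} → ⟦ s ⟧ × All ⟦_⟧ ss → All ⟦_⟧ (s ∷ ss)
    cons (v , vs) = v ∷ vs

  mutual
    evalT-cong : ∀ {F Γ s} (t : Term Γ s) {ρ ρ′ : Env F Γ} → ρ ≋ ρ′ → evalT t ρ ≈ evalT t ρ′
    evalT-cong (var x)    E = lookup-≋ E x
    evalT-cong zeroT      E = ≈-refl
    evalT-cong (sucT t)   E = mapElt-cong suc (evalT-cong t E)
    evalT-cong (app f as) E = mapElt-cong (funI f) (evalA-cong as E)

    evalA-cong : ∀ {F Γ ss} (as : Args Γ ss) {ρ ρ′ : Env F Γ} → ρ ≋ ρ′ → evalA as ρ ≈ evalA as ρ′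
    evalA-cong []       E = ≈-refl
    evalA-cong (t ∷ as) E = mapElt-cong cons (pairElt-cong (evalT-cong t E) (evalA-cong as E))

  mutual
    evalT-restrict : ∀ {G F Γ s} (β : Hom G F) (t : Term Γ s) (ρ : Env F Γ) →
                     evalT t (restrictEnv β ρ) ≈ restrict β (evalT t ρ)
    evalT-restrict β (var x)    ρ = ≈-reflexive (lookup-map ρ x)
    evalT-restrict β zeroT      ρ = ≈-sym (restrict-const β zero)
    evalT-restrict β (sucT t)   ρ = mapElt-cong suc (evalT-restrict β t ρ)
    evalT-restrict β (app f as) ρ = mapElt-cong (funI f) (evalA-restrict β as ρ)

    evalA-restrict : ∀ {G F Γ ss} (β : Hom G F) (as : Args Γ ss) (ρ : Env F Γ) →
                     evalA as (restrictEnv β ρ) ≈ restrict β (evalA as ρ)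
    evalA-restrict β []       ρ = ≈-sym (restrict-const β [])
    evalA-restrict β (t ∷ as) ρ = mapElt-cong cons (≈-trans
      (pairElt-cong (evalT-restrict β t ρ) (evalA-restrict β as ρ))
      (≈-sym (restrict-pair β (evalT t ρ) (evalA as ρ))))

  forces-resp-≋ : ∀ {Γ} (φ : Formula Γ) {F} {ρ ρ′ : Env F Γ} → ρ ≋ ρ′ → Forces φ F ρ → Forces φ F ρ′
  forces-resp-≋ (rel R as) E (lift h) = lift (InSub-resp-≈ (relI R) (evalA-cong as E) h)
  forces-resp-≋ (t ≐ u)    E (lift h) = lift (Equivalence.to (EqElt-cong (evalT-cong t E) (evalT-cong u E)) h)
  forces-resp-≋ (st t)     E (lift h) = lift (FinVal-resp-≈ (evalT-cong t E) h)
  forces-resp-≋ ⊤ᶠ         E h = h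
  forces-resp-≋ ⊥ᶠ         E h = h
  forces-resp-≋ (φ ∧ᶠ ψ)   E (hφ , hψ) = forces-resp-≋ φ E hφ , forces-resp-≋ ψ E hψ
  forces-resp-≋ (φ ∨ᶠ ψ)   E (n , fam , cov , h) = n , fam , cov , λ k →
    let E′ = restrictEnv-cong (proj₂ (fam k)) E in Sum.map (forces-resp-≋ φ E′) (forces-resp-≋ ψ E′) (h k)
  forces-resp-≋ (φ ⇒ ψ)    E h G β hφ =
    forces-resp-≋ ψ (restrictEnv-cong β E) (h G β (forces-resp-≋ φ (restrictEnv-cong β (≋-sym E)) hφ))
  forces-resp-≋ (∀ᶠ s φ)   E h G β b = forces-resp-≋ φ (≈-refl , restrictEnv-cong β E) (h G β b)
  forces-resp-≋ (∃ᶠ s φ)   E (n , fam , cov , h) = n , fam , cov , λ k →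
    let (b , hb) = h k in b , forces-resp-≋ φ (≈-refl , restrictEnv-cong (proj₂ (fam k)) E) hb

  -- Forces (φ ∨ᶠ ψ) F ρ and Forces (∃ᶠ s φ) F ρ unfold to Locally F (EitherAt φ ψ ρ) and Locally F (WitnessAt s φ ρ).
  EitherAt : ∀ {Γ} → Formula Γ → Formula Γ → ∀ {F} → Env F Γ → Σ Obj (λ G → Hom G F) → Set₁
  EitherAt φ ψ ρ (G , β) = Forces φ G (restrictEnv β ρ) ⊎ Forces ψ G (restrictEnv β ρ)

  WitnessAt : ∀ {Γ} s → Formula (s ∷ Γ) → ∀ {F} → Env F Γ → Σ Obj (λ G → Hom G F) → Set₁
  WitnessAt s φ ρ (G , β) = Σ (Elt G ⟦ s ⟧) λ b → Forces φ G (b ∷ restrictEnv β ρ)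

  forces-cong : ∀ {Γ} (φ : Formula Γ) {F} {ρ ρ′ : Env F Γ} → ρ ≋ ρ′ → Forces φ F ρ ⇔ Forces φ F ρ′
  forces-cong φ E = mk⇔ (forces-resp-≋ φ E) (forces-resp-≋ φ (≋-sym E))

  forces-⊥⇒Empty : ∀ {Γ F} (ρ : Env F Γ) → Forces ⊥ᶠ F ρ → Empty F
  forces-⊥⇒Empty {F = F} ρ (lift c) = eventually-map {F} (λ { (() , _) }) (c (λ ()))

  Empty⇒forces-⊥ : ∀ {Γ F} (ρ : Env F Γ) → Empty F → Forces ⊥ᶠ F ρ
  Empty⇒forces-⊥ ρ (i , h) = lift (λ _ → i , λ x p → ⊥-elim (h x p))

  forces-empty : ∀ {Γ} (φ : Formula Γ) {F} (ρ : Env F Γ) → Empty F → Forces φ F ρ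
  forces-empty (rel R as) ρ (i , e) = lift (i , λ x p → ⊥-elim (e x p))
  forces-empty (t ≐ u)    ρ (i , e) = lift (i , λ x p → ⊥-elim (e x p))
  forces-empty (st t)     ρ (i , e) = lift (i , 0 , (λ ()) , λ x p → ⊥-elim (e x p))
  forces-empty ⊤ᶠ         ρ e = lift tt
  forces-empty ⊥ᶠ         ρ e = Empty⇒forces-⊥ ρ e
  forces-empty (φ ∧ᶠ ψ)   ρ e = forces-empty φ ρ e , forces-empty ψ ρ e
  forces-empty (φ ∨ᶠ ψ)   ρ e = Locally-empty (EitherAt φ ψ ρ) e
  forces-empty (φ ⇒ ψ)    ρ e G β _ = forces-empty ψ _ (Empty-restrict β e)
  forces-empty (∀ᶠ s φ)   ρ e G β b = forces-empty φ _ (Empty-restrict β e)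
  forces-empty (∃ᶠ s φ)   ρ e = Locally-empty (WitnessAt s φ ρ) e

  forces-restrict : ∀ {Γ} (φ : Formula Γ) {G F} (β : Hom G F) (ρ : Env F Γ) →
                    Forces φ F ρ → Forces φ G (restrictEnv β ρ)
  forces-restrict (rel R as) β ρ (lift h) =
    lift (InSub-resp-≈ (relI R) (≈-sym (evalA-restrict β as ρ)) (InSub-restrict β (relI R) (evalA as ρ) h))
  forces-restrict (t ≐ u)    β ρ (lift h) =
    lift (Equivalence.from (EqElt-cong (evalT-restrict β t ρ) (evalT-restrict β u ρ))
                           (agree (restrict-cong β (mk≈ h))))
  forces-restrict (st t)     β ρ (lift h) =
    lift (FinVal-resp-≈ (≈-sym (evalT-restrict β t ρ)) (FinVal-restrict β h))
  forces-restrict ⊤ᶠ         β ρ h = lift tt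
  forces-restrict ⊥ᶠ         β ρ h = Empty⇒forces-⊥ (restrictEnv β ρ) (Empty-restrict β (forces-⊥⇒Empty ρ h))
  forces-restrict (φ ∧ᶠ ψ)   β ρ (hφ , hψ) = forces-restrict φ β ρ hφ , forces-restrict ψ β ρ hψ
  forces-restrict (φ ⇒ ψ)    β ρ h H γ hφ =
    forces-resp-≋ ψ (restrictEnv-∘ β γ ρ) (h H (β ∘ʰ γ) (forces-resp-≋ φ (≋-sym (restrictEnv-∘ β γ ρ)) hφ))
  forces-restrict (∀ᶠ s φ)   β ρ h H γ b = forces-resp-≋ φ (≈-refl , restrictEnv-∘ β γ ρ) (h H (β ∘ʰ γ) b)
  forces-restrict (φ ∨ᶠ ψ)   β ρ (n , fam , cov , h) = n , pullbackFamily fam β , pullback-Covers fam β cov , λ k →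
    let π₁ = Pullback.π₁ (proj₂ (fam k)) β
        E  = restrictEnv-pullback-square (proj₂ (fam k)) β ρ
    in Sum.map (λ hφ → forces-resp-≋ φ E (forces-restrict φ π₁ _ hφ))
               (λ hψ → forces-resp-≋ ψ E (forces-restrict ψ π₁ _ hψ)) (h k)
  forces-restrict (∃ᶠ s φ)   β ρ (n , fam , cov , h) = n , pullbackFamily fam β , pullback-Covers fam β cov , λ k →
    let π₁ = Pullback.π₁ (proj₂ (fam k)) β
        (b , hb) = h k
    in restrict π₁ b ,
       forces-resp-≋ φ (≈-refl , restrictEnv-pullback-square (proj₂ (fam k)) β ρ) (forces-restrict φ π₁ _ hb)

  forces-mp : ∀ {Γ} (φ ψ : Formula Γ) {F} {ρ : Env F Γ} → Forces (φ ⇒ ψ) F ρ → Forces φ F ρ → Forces ψ F ρ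
  forces-mp φ ψ {F} {ρ} h hφ =
    forces-resp-≋ ψ (restrictEnv-id ρ) (h F idʰ (forces-resp-≋ φ (≋-sym (restrictEnv-id ρ)) hφ))

  forces-∀-elim : ∀ {Γ s} (φ : Formula (s ∷ Γ)) {F} {ρ : Env F Γ} →
                  Forces (∀ᶠ s φ) F ρ → (b : Elt F ⟦ s ⟧) → Forces φ F (b ∷ ρ)
  forces-∀-elim φ {F} {ρ} h b = forces-resp-≋ φ (≈-refl , restrictEnv-id ρ) (h F idʰ b)

  forces-∀ˢᵗ-elim : ∀ {Γ s} (φ : Formula (s ∷ Γ)) {G} {ρ : Env G Γ} → Forces (∀ˢᵗ s φ) G ρ →
                    ∀ {K} (θ : Hom K G) (c : Elt K ⟦ s ⟧) → FinVal c → Forces φ K (c ∷ restrictEnv θ ρ)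
  forces-∀ˢᵗ-elim φ h θ c std = forces-mp (st (var (here refl))) φ (h _ θ c) (lift std)

  forces-↾-pull : ∀ {Γ} (φ : Formula Γ) {H F} (δ : Hom H F) (P : Subset F) (ρ : Env F Γ) →
                  Forces φ (F ↾ P) (restrictEnv (incl P) ρ) →
                  Forces φ (H ↾ pullSubset δ P) (restrictEnv (incl (pullSubset δ P)) (restrictEnv δ ρ))
  forces-↾-pull φ δ P ρ h = forces-resp-≋ φ (restrictEnv-↾-square δ P ρ) (forces-restrict φ (δ ↾ʰ P) _ h)

  forces-glue : ∀ {Γ} (φ : Formula Γ) {F} (C : BinaryCover F) (ρ : Env F Γ) →
                Forces φ (F ↾ left C) (restrictEnv (incl (left C)) ρ) →
                Forces φ (F ↾ right C) (restrictEnv (incl (right C)) ρ) → Forces φ F ρ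
  forces-glue (rel R as) C ρ (lift hl) (lift hr) = lift (Glue.InSub-glue C (relI R) (evalA as ρ)
    (InSub-resp-≈ (relI R) (evalA-restrict (incl (left C)) as ρ) hl)
    (InSub-resp-≈ (relI R) (evalA-restrict (incl (right C)) as ρ) hr))
  forces-glue (t ≐ u) C ρ (lift hl) (lift hr) =
    lift (agree (Glue.≈-glue C (unrestrict (left C) hl) (unrestrict (right C) hr)))
    where
    unrestrict : ∀ P → EqElt (evalT t (restrictEnv (incl P) ρ)) (evalT u (restrictEnv (incl P) ρ)) →
                 restrict (incl P) (evalT t ρ) ≈ restrict (incl P) (evalT u ρ)
    unrestrict P = mk≈ ∘ Equivalence.to (EqElt-cong (evalT-restrict (incl P) t ρ) (evalT-restrict (incl P) u ρ))
  forces-glue (st t) C ρ (lift hl) (lift hr) = lift (Glue.FinVal-glue C (evalT t ρ)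
    (FinVal-resp-≈ (evalT-restrict (incl (left C)) t ρ) hl)
    (FinVal-resp-≈ (evalT-restrict (incl (right C)) t ρ) hr))
  forces-glue ⊤ᶠ C ρ hl hr = lift tt
  forces-glue ⊥ᶠ C ρ hl hr =
    Empty⇒forces-⊥ ρ (Glue.eventually-glue C (forces-⊥⇒Empty (restrictEnv (incl (left C)) ρ) hl)
                                             (forces-⊥⇒Empty (restrictEnv (incl (right C)) ρ) hr))
  forces-glue (φ ∧ᶠ ψ) C ρ (hφl , hψl) (hφr , hψr) = forces-glue φ C ρ hφl hφr , forces-glue ψ C ρ hψl hψr
  forces-glue (φ ⇒ ψ) C ρ hl hr H δ hφ = forces-glue ψ (pullCover δ C) (restrictEnv δ ρ)
    (forces-mp φ ψ (forces-↾-pull (φ ⇒ ψ) δ (left C) ρ hl) (forces-restrict φ (incl (pullSubset δ (left C))) _ hφ))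
    (forces-mp φ ψ (forces-↾-pull (φ ⇒ ψ) δ (right C) ρ hr) (forces-restrict φ (incl (pullSubset δ (right C))) _ hφ))
  forces-glue (∀ᶠ s φ) C ρ hl hr H δ b = forces-glue φ (pullCover δ C) (b ∷ restrictEnv δ ρ)
    (forces-∀-elim φ (forces-↾-pull (∀ᶠ s φ) δ (left C) ρ hl) (restrict (incl (pullSubset δ (left C))) b))
    (forces-∀-elim φ (forces-↾-pull (∀ᶠ s φ) δ (right C) ρ hr) (restrict (incl (pullSubset δ (right C))) b))
  forces-glue (φ ∨ᶠ ψ) {F} C ρ hl hr = Glue.Locally-glue C (EitherAt φ ψ ρ) widened widened hl hr
    where
    widened : ∀ {P G} (β : Hom G (F ↾ P)) →
              EitherAt φ ψ (restrictEnv (incl P) ρ) (G , β) → EitherAt φ ψ ρ (G , widen β)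
    widened β = Sum.map (forces-resp-≋ φ (restrictEnv-widen β ρ)) (forces-resp-≋ ψ (restrictEnv-widen β ρ))
  forces-glue (∃ᶠ s φ) {F} C ρ hl hr = Glue.Locally-glue C (WitnessAt s φ ρ) widened widened hl hr
    where
    widened : ∀ {P G} (β : Hom G (F ↾ P)) →
              WitnessAt s φ (restrictEnv (incl P) ρ) (G , β) → WitnessAt s φ ρ (G , widen β)
    widened β (b , hb) = b , forces-resp-≋ φ (≈-refl , restrictEnv-widen β ρ) hb

  -- Substitution

  substEnv : ∀ {F Γ Δ} → Sub Γ Δ → Env F Δ → Env F Γ
  substEnv {Γ = []}    σ ρ = []
  substEnv {Γ = s ∷ Γ} σ ρ = evalT (σ (here refl)) ρ ∷ substEnv (λ x → σ (there x)) ρ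

  lookup-substEnv : ∀ {F Γ Δ t} (σ : Sub Γ Δ) (ρ : Env F Δ) (x : t ∈ Γ) →
                    All.lookup (substEnv σ ρ) x ≡ evalT (σ x) ρ
  lookup-substEnv σ ρ (here refl) = refl
  lookup-substEnv σ ρ (there x)   = lookup-substEnv (λ y → σ (there y)) ρ x

  substEnv-≋ : ∀ {F Γ Δ} (σ : Sub Γ Δ) (ρ : Env F Δ) (ρ′ : Env F Γ) →
               (∀ {t} (x : t ∈ Γ) → evalT (σ x) ρ ≈ All.lookup ρ′ x) → substEnv σ ρ ≋ ρ′
  substEnv-≋ σ ρ []       h = tt
  substEnv-≋ σ ρ (a ∷ ρ′) h = h (here refl) , substEnv-≋ (λ y → σ (there y)) ρ ρ′ (λ x → h (there x))

  substEnv-restrict : ∀ {G F Γ Δ} (σ : Sub Γ Δ) (β : Hom G F) (ρ : Env F Δ) →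
                      substEnv σ (restrictEnv β ρ) ≋ restrictEnv β (substEnv σ ρ)
  substEnv-restrict {Γ = []}    σ β ρ = tt
  substEnv-restrict {Γ = s ∷ Γ} σ β ρ =
    evalT-restrict β (σ (here refl)) ρ , substEnv-restrict (λ y → σ (there y)) β ρ

  mutual
    evalT-subst : ∀ {F Γ Δ s} (σ : Sub Γ Δ) (t : Term Γ s) (ρ : Env F Δ) →
                  evalT (subT σ t) ρ ≈ evalT t (substEnv σ ρ)
    evalT-subst σ (var x)    ρ = ≈-reflexive (sym (lookup-substEnv σ ρ x))
    evalT-subst σ zeroT      ρ = ≈-refl
    evalT-subst σ (sucT t)   ρ = mapElt-cong suc (evalT-subst σ t ρ)
    evalT-subst σ (app f as) ρ = mapElt-cong (funI f) (evalA-subst σ as ρ)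

    evalA-subst : ∀ {F Γ Δ ss} (σ : Sub Γ Δ) (as : Args Γ ss) (ρ : Env F Δ) →
                  evalA (subA σ as) ρ ≈ evalA as (substEnv σ ρ)
    evalA-subst σ []       ρ = ≈-refl
    evalA-subst σ (t ∷ as) ρ = mapElt-cong cons (pairElt-cong (evalT-subst σ t ρ) (evalA-subst σ as ρ))

  mutual
    evalT-weaken : ∀ {F Γ s s′} (t : Term Γ s) (b : Elt F ⟦ s′ ⟧) (ρ : Env F Γ) →
                   evalT (renT (there {x = s′}) t) (b ∷ ρ) ≡ evalT t ρ
    evalT-weaken (var x)    b ρ = refl
    evalT-weaken zeroT      b ρ = refl
    evalT-weaken (sucT t)   b ρ = cong (mapElt suc) (evalT-weaken t b ρ)
    evalT-weaken (app f as) b ρ = cong (mapElt (funI f)) (evalA-weaken as b ρ)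

    evalA-weaken : ∀ {F Γ ss s′} (as : Args Γ ss) (b : Elt F ⟦ s′ ⟧) (ρ : Env F Γ) →
                   evalA (renA (there {x = s′}) as) (b ∷ ρ) ≡ evalA as ρ
    evalA-weaken []       b ρ = refl
    evalA-weaken (t ∷ as) b ρ =
      cong₂ (λ a as → mapElt cons (pairElt a as)) (evalT-weaken t b ρ) (evalA-weaken as b ρ)

  substEnv-lift : ∀ {G F Γ Δ s} (σ : Sub Γ Δ) (β : Hom G F) (ρ : Env F Δ) (b : Elt G ⟦ s ⟧) →
                  substEnv (liftSub {s = s} σ) (b ∷ restrictEnv β ρ) ≋ b ∷ restrictEnv β (substEnv σ ρ)
  substEnv-lift {s = s} σ β ρ b = ≈-refl , ≋-trans
    (substEnv-≋ (λ x → renT (there {x = s}) (σ x)) (b ∷ restrictEnv β ρ) (substEnv σ (restrictEnv β ρ))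
       (λ x → ≈-reflexive (trans (evalT-weaken (σ x) b _) (sym (lookup-substEnv σ _ x)))))
    (substEnv-restrict σ β ρ)

  mutual
    forces-subst : ∀ {Γ Δ} (φ : Formula Γ) (σ : Sub Γ Δ) {F} (ρ : Env F Δ) →
                   Forces (subF σ φ) F ρ ⇔ Forces φ F (substEnv σ ρ)
    forces-subst (rel R as) σ ρ = Lift-⇔ (InSub-cong (relI R) (evalA-subst σ as ρ))
    forces-subst (t ≐ u)    σ ρ = Lift-⇔ (EqElt-cong (evalT-subst σ t ρ) (evalT-subst σ u ρ))
    forces-subst (st t)     σ ρ = Lift-⇔ (FinVal-cong (evalT-subst σ t ρ))
    forces-subst ⊤ᶠ         σ ρ = ⇔-id _
    forces-subst ⊥ᶠ         σ ρ = ⇔-id _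
    forces-subst (φ ∧ᶠ ψ)   σ ρ = forces-subst φ σ ρ ×-⇔ forces-subst ψ σ ρ
    forces-subst (φ ∨ᶠ ψ)   σ ρ = Σ-⇔ (↠-id _) (Σ-⇔ (↠-id _) λ {fam} → ⇔-id _ ×-⇔ Π-⇔ λ k →
      forces-subst-restrict φ σ (proj₂ (fam k)) ρ ⊎-⇔ forces-subst-restrict ψ σ (proj₂ (fam k)) ρ)
    forces-subst (φ ⇒ ψ)    σ ρ = Π-⇔ λ G → Π-⇔ λ β →
      →-cong-⇔ (forces-subst-restrict φ σ β ρ) (forces-subst-restrict ψ σ β ρ)
    forces-subst (∀ᶠ s φ)   σ ρ = Π-⇔ λ G → Π-⇔ λ β → Π-⇔ λ b → forces-subst-lift φ σ β ρ b
    forces-subst (∃ᶠ s φ)   σ ρ = Σ-⇔ (↠-id _) (Σ-⇔ (↠-id _) λ {fam} → ⇔-id _ ×-⇔ Π-⇔ λ k →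
      Σ-⇔ (↠-id _) λ {b} → forces-subst-lift φ σ (proj₂ (fam k)) ρ b)

    forces-subst-restrict : ∀ {Γ Δ} (φ : Formula Γ) (σ : Sub Γ Δ) {G F} (β : Hom G F) (ρ : Env F Δ) →
                            Forces (subF σ φ) G (restrictEnv β ρ) ⇔ Forces φ G (restrictEnv β (substEnv σ ρ))
    forces-subst-restrict φ σ β ρ = forces-cong φ (substEnv-restrict σ β ρ) ⇔-∘ forces-subst φ σ (restrictEnv β ρ)

    forces-subst-lift : ∀ {Γ Δ s} (φ : Formula (s ∷ Γ)) (σ : Sub Γ Δ) {G F} (β : Hom G F) (ρ : Env F Δ)
                        (b : Elt G ⟦ s ⟧) → Forces (subF (liftSub σ) φ) G (b ∷ restrictEnv β ρ) ⇔
                                            Forces φ G (b ∷ restrictEnv β (substEnv σ ρ))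
    forces-subst-lift φ σ β ρ b =
      forces-cong φ (substEnv-lift σ β ρ b) ⇔-∘ forces-subst φ (liftSub σ) (b ∷ restrictEnv β ρ)

  -- External induction

  module ExternalInduction {Γ} (Φ : Formula (natS ∷ Γ)) {G} (ρ : Env G Γ)
    (Φ0 : Forces Φ G (constElt 0 ∷ ρ))
    (ΦS : ∀ {K} (θ : Hom K G) (c : Elt K ℕ) → FinVal c →
          Forces Φ K (c ∷ restrictEnv θ ρ) → Forces Φ K (mapElt suc c ∷ restrictEnv θ ρ)) where

    forces-bounded : ∀ N {K} (θ : Hom K G) (c : Elt K ℕ) → InSub (_< N) c → Forces Φ K (c ∷ restrictEnv θ ρ)
    forces-bounded zero    {K} θ c c<0   = forces-empty Φ _ (eventually-map {K} (λ (_ , lt) → n≮0 lt) c<0)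
    forces-bounded (suc N)     θ c c<1+N = forces-glue Φ C (c ∷ restrictEnv θ ρ) on-positive on-zero
      where
      C = preimageCover c (0 <_) (0 ≡_) (λ _ → <-irrelevant) (λ _ → ≡-irrelevant) (λ _ → m≤n⇒m<n∨m≡n z≤n)

      c⁰ = restrict (incl (right C)) c
      c⁰≡0 : InSub (0 ≡_) c⁰
      c⁰≡0 = InSub-on-preimage c (0 ≡_) (λ _ → ≡-irrelevant)

      on-zero : Forces Φ _ (restrictEnv (incl (right C)) (c ∷ restrictEnv θ ρ))
      on-zero = forces-resp-≋ Φ
        (≈-trans (restrict-const (θ ∘ʰ incl (right C)) 0) (const-≈ c⁰ c⁰≡0) , restrictEnv-∘ θ (incl (right C)) ρ)
        (forces-restrict Φ (θ ∘ʰ incl (right C)) _ Φ0)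

      c⁺ = restrict (incl (left C)) c
      c⁺>0 : InSub (0 <_) c⁺
      c⁺>0 = InSub-on-preimage c (0 <_) (λ _ → <-irrelevant)
      c⁺-1<N : InSub (_< N) (mapElt pred c⁺)
      c⁺-1<N = InSub-zip {R = _< suc N} c⁺ (λ lt pos → pred-mono-< {{>-nonZero pos}} lt)
                 (InSub-restrict (incl (left C)) (_< suc N) c c<1+N) c⁺>0

      on-positive : Forces Φ _ (restrictEnv (incl (left C)) (c ∷ restrictEnv θ ρ))
      on-positive = forces-resp-≋ Φ (suc-pred-≈ c⁺ c⁺>0 , restrictEnv-∘ θ (incl (left C)) ρ)
        (ΦS (θ ∘ʰ incl (left C)) (mapElt pred c⁺) (bounded⇒FinVal N (mapElt pred c⁺) c⁺-1<N)
            (forces-bounded N (θ ∘ʰ incl (left C)) (mapElt pred c⁺) c⁺-1<N))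

  forces-ExtInd : ∀ {Γ} (Φ : Formula (natS ∷ Γ)) {F} (ρ : Env F Γ) → Forces (ExtInd Φ) F ρ
  forces-ExtInd Φ ρ G β (hz , hs) H γ b K δ (lift std) =
    let (N , b<N) = FinVal⇒bounded (restrict δ b) std in
    forces-resp-≋ Φ (≈-refl , restrictEnv-∘ γ δ ρG)
      (ExternalInduction.forces-bounded Φ ρG Φ0 ΦS N (γ ∘ʰ δ) (restrict δ b) b<N)
    where
    ρG = restrictEnv β ρ
    -- The environments of the substitutions in instantiate Φ zeroT and atSuc Φ compute to
    -- constElt 0 ∷ ρG and mapElt suc c ∷ restrictEnv θ ρG, hence the pointwise ≈-refl.
    Φ0 : Forces Φ G (constElt 0 ∷ ρG)
    Φ0 = forces-resp-≋ Φ (≈-refl , substEnv-≋ _ ρG ρG (λ _ → ≈-refl)) (Equivalence.to (forces-subst Φ _ ρG) hz)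
    ΦS : ∀ {K} (θ : Hom K G) (c : Elt K ℕ) → FinVal c →
         Forces Φ K (c ∷ restrictEnv θ ρG) → Forces Φ K (mapElt suc c ∷ restrictEnv θ ρG)
    ΦS θ c std hc = forces-resp-≋ Φ (≈-refl , substEnv-≋ _ _ _ (λ _ → ≈-refl))
      (Equivalence.to (forces-subst Φ _ _) (forces-mp Φ (atSuc Φ) (forces-∀ˢᵗ-elim (Φ ⇒ atSuc Φ) hs θ c std) hc))

  closure-valid : ∀ Γ (φ : Formula Γ) → (∀ {F} (ρ : Env F Γ) → Forces φ F ρ) → Valid (closure Γ φ)
  closure-valid []      φ h = h []
  closure-valid (s ∷ Γ) φ h = closure-valid Γ (∀ᶠ s φ) (λ ρ G β b → h (b ∷ restrictEnv β ρ))

mainTheorem11 : (L : Language) → let open Syntax L in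
    (Γ : Ctx) (Φ : Formula (natS ∷ Γ)) → Valid (closure Γ (ExtInd Φ))
mainTheorem11 L Γ Φ = closure-valid Γ (ExtInd Φ) (forces-ExtInd Φ)
  where
  open Syntax L
  open Semantics L
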